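{- For every integer $n\ge2$, $\operatorname{ldim}_2(S_n)\le \log n+\tfrac12\log\log n+4$, where $S_n$ is the standard example.
   Context: Logarithms are base $2$. The standard example $S_n$ is the suborder of the Boolean lattice of subsets of $[n]$ (ordered by inclusion) consisting of all subsets of cardinality $1$ and all subsets of cardinality $n-1$. A partial function $f$ from a poset to a chain is monotone if $x\le y$ with $x,y\in\operatorname{dom}(f)$ implies $f(x)\le f(y)$. A local $2$-realiser of $P$ is a set $\mathcal{R}$ of monotone partial functions from $P$ to the $2$-element chain such that for all $x,y\in P$ with $x\not\ge y$ there is $f\in\mathcal{R}$ with $x,y\in\operatorname{dom}(f)$ and $f(x)<f(y)$; $\mu_{\mathcal{R}}(x)$ is the number of $f\in\mathcal{R}$ with $x\in\operatorname{dom}(f)$; $\operatorname{ldim}_2(P)$ is the minimum over local $2$-realisers of $\max_x\mu_{\mathcal{R}}(x)$. -}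

module Defs where

open import Data.Nat using (ℕ; _∸_; _≡ᵇ_)
open import Data.Bool using (Bool; true; false; T; _∨_)
import Data.Bool as B
open import Data.Maybe using (Maybe; just; is-just)
open import Data.List using (List; length; filter)
open import Data.List.Membership.Propositional using (_∈_)
open import Data.Product using (Σ; ∃; _×_; _,_; proj₁)
open import Data.Fin.Subset using (Subset; ∣_∣) renaming (_⊆_ to _⊆ˢ_)
open import Relation.Binary.PropositionalEquality using (_≡_)
open import Relation.Nullary using (¬_)
open import Relation.Unary using () renaming (Decidable to DecU)
open import Relation.Nullary.Decidable using (yes; no)
open import Data.Bool.Properties using () renaming (T? to T?)

-- A partial function from A to the 2-element chain {false < true}:
-- f x ≡ nothing means x ∉ dom f.
PartialFn : Set → Set
PartialFn A = A → Maybe Bool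

Monotone : {A : Set} → (A → A → Set) → PartialFn A → Set
Monotone {A} _≼_ f =
  ∀ (x y : A) (a b : Bool) → f x ≡ just a → f y ≡ just b → x ≼ y → a B.≤ b

IsLocal2Realiser : {A : Set} → (A → A → Set) → List (PartialFn A) → Set
IsLocal2Realiser {A} _≼_ R =
  (∀ f → f ∈ R → Monotone _≼_ f) ×
  (∀ (x y : A) → ¬ (y ≼ x) →
     ∃ λ f → f ∈ R × f x ≡ just false × f y ≡ just true)

μ : {A : Set} → List (PartialFn A) → A → ℕ
μ R x = length (filter (λ f → T? (is-just (f x))) R)

Ldim2AtMost : {A : Set} → (A → A → Set) → ℕ → Set
Ldim2AtMost {A} _≼_ m =
  ∃ λ (R : List (PartialFn A)) → IsLocal2Realiser _≼_ R × (∀ x → μ R x Data.Nat.≤ m)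
  where import Data.Nat

InS : (n : ℕ) → Subset n → Set
InS n s = T ((∣ s ∣ ≡ᵇ 1) ∨ (∣ s ∣ ≡ᵇ n ∸ 1))

Sₙ : ℕ → Set
Sₙ n = Σ (Subset n) (InS n)

_⊑_ : {n : ℕ} → Sₙ n → Sₙ n → Set
x ⊑ y = proj₁ x ⊆ˢ proj₁ y

-- View Sₙ as atoms aᵢ = {i} and coatoms bⱼ = [n] ∖ {j}, with aᵢ < bⱼ exactly when i ≢ j.
-- Give every i a code cᵢ ⊆ [K] such that no code contains another one; the ⌊K/2⌋-subsets
-- of [K] provide C(K, ⌊K/2⌋) such codes.  The partial functions "k ∈ cᵢ" on the atoms, the
-- same on the coatoms, the rank (aᵢ ↦ 0, bⱼ ↦ 1), and for each j the function aⱼ ↦ 1, bⱼ ↦ 0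
-- defined only on {aⱼ, bⱼ} form a local 2-realiser in which every point lies in K + 2 domains.
-- Take K least with n ≤ C(K, ⌊K/2⌋); then K ≤ 2 log n for n ≥ 8 (smaller n are checked
-- directly), and the estimate 4ᴶ ≤ 2(J+1)·C(J, ⌊J/2⌋)² at J = K - 1 gives
-- 4ᴷ ≤ 8K·n² ≤ 16·n²·log n, that is K + 2 ≤ log n + ½ log log n + 4.

{-# OPTIONS --safe #-}
module Submission where

open import Defs
open import Data.Nat using (ℕ; _≤_; _^_; _*_)
open import Data.Product using (∃; _×_)

open import Algebra.Lattice.Properties.BooleanAlgebra using (¬-involutive)
open import Data.Bool as Bool using (Bool; true; false; T; not; f≤t)
open import Data.Bool.Properties using (T?; T-∨) renaming (≤-reflexive to Bool-≤-reflexive)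
open import Data.Empty using (⊥-elim)
open import Data.Fin using (Fin; zero; suc; inject≤)
open import Data.Fin.Properties using (0≢1+n; _≟_; ¬∀⟶∃¬; inject≤-injective)
  renaming (suc-injective to Fin-suc-injective)
open import Data.Fin.Subset using (Subset; _⊆_; inside; outside; ⊥; ⁅_⁆; ∁; ∣_∣)
  renaming (_∈_ to _∈ˢ_; _∉_ to _∉ˢ_)
open import Data.Fin.Subset.Properties
  using (_∈?_; _⊆?_; ⊆-antisym; x∈⁅x⁆; x∈⁅y⁆⇒x≡y; x≢y⇒x∉⁅y⁆; x∉⁅y⁆⇒x≢y; x∈∁p⇒x∉p; x∉p⇒x∈∁p;
         ∁p⊆∁q⇒p⊇q; p⊆q⇒∣p∣≤∣q∣; p⊂q⇒∣p∣<∣q∣; ∣⁅x⁆∣≡1; ∣∁p∣≡n∸∣p∣; ∪-∩-booleanAlgebra)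
open import Data.List using (List; []; _∷_; _++_; length; filter; tabulate; map; lookup)
open import Data.List.Properties
  using (filter-++; filter-none; length-++; length-filter; length-map; length-tabulate)
open import Data.List.Membership.Propositional using (_∈_)
open import Data.List.Membership.Propositional.Properties
  using (∈-map⁺; ∈-map⁻; ∈-++⁺ˡ; ∈-++⁺ʳ; ∈-tabulate⁺; ∈-lookup)
open import Data.List.Relation.Unary.All using (All; []; _∷_)
  renaming (lookup to All-lookup; map to All-map)
import Data.List.Relation.Unary.All.Properties as All
open import Data.List.Relation.Unary.AllPairs using ([]; _∷_)
open import Data.List.Relation.Unary.Any using (here; there)
open import Data.List.Relation.Unary.Unique.Propositional using (Unique)
import Data.List.Relation.Unary.Unique.Propositional.Properties as Unique
open import Data.Maybe using (Maybe; just; nothing; is-just; when)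
open import Data.Maybe.Properties using (just-injective)
open import Data.Nat using (zero; suc; _+_; _∸_; _<_; _≡ᵇ_; z≤n; s≤s; z<s; s<s; ⌊_/2⌋)
open import Data.Nat.Combinatorics using (_C_; k>n⇒nCk≡0; nCk+nC[k+1]≡[n+1]C[k+1]; nC1≡n; nCk≡nC[n∸k])
open import Data.Nat.Properties
  using (≤-refl; ≤-reflexive; ≤-trans; ≤-pred; <⇒≤; <⇒≱; ≤⇒≯; ≰⇒>; ≤∧≢⇒<; n≤1+n; n<1+n; m<n⇒m<1+n;
         m≤m+n; m≤n+m; +-suc; +-comm; +-assoc; +-identityʳ; +-mono-≤; ∸-monoˡ-≤; m∸[m∸n]≡n; m+n∸n≡m;
         *-assoc; *-zeroʳ; *-identityʳ; *-distribˡ-+; *-mono-≤; *-monoˡ-≤; *-monoʳ-≤; *-cancelˡ-≤;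
         ^-*-assoc; ^-distribˡ-+-*; ^-monoˡ-≤; ^-monoʳ-≤; m^n>0; n≡⌊n+n/2⌋; n≡⌈n+n/2⌉;
         ≡ᵇ⇒≡; ≤ᵇ⇒≤; _≤?_; suc-injective; module ≤-Reasoning)
  renaming (_≟_ to _≟ℕ_)
open import Data.Nat.Tactic.RingSolver using (solve-∀)
open import Data.Product using (Σ; ∃₂; _,_; proj₁)
open import Data.Sum using (inj₁; inj₂)
open import Data.Unit using (⊤; tt)
open import Data.Vec using ([]; _∷_; head)
import Data.Vec as Vec
open import Data.Vec.Properties using (∷-injectiveʳ)
open import Function using (_∘_)
open import Function.Bundles using (Equivalence)
open import Relation.Binary.PropositionalEquality
  using (_≡_; _≢_; refl; sym; trans; cong; cong₂; subst; subst₂; module ≡-Reasoning)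
open import Relation.Nullary using (¬_; yes; no; does; contradiction)
open import Relation.Nullary.Decidable using (dec-true; dec-false; _→-dec_)

-- Local realisers

module _ {A : Set} where

  same-point⇒≤ : ∀ {f : PartialFn A} {x a b} → f x ≡ just a → f x ≡ just b → a Bool.≤ b
  same-point⇒≤ fa fb = Bool-≤-reflexive (just-injective (trans (sym fa) fb))

  μ-++ : ∀ (fs gs : List (PartialFn A)) x → μ (fs ++ gs) x ≡ μ fs x + μ gs x
  μ-++ fs gs x = trans (cong length (filter-++ _ fs gs)) (length-++ (filter _ fs))

  μ-tabulate-≤ : ∀ {m} (fs : Fin m → PartialFn A) x → μ (tabulate fs) x ≤ m
  μ-tabulate-≤ fs x = ≤-trans (length-filter _ (tabulate fs)) (≤-reflexive (length-tabulate fs))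

  μ-tabulate-undefined : ∀ {m} (fs : Fin m → PartialFn A) x →
                         (∀ i → ¬ T (is-just (fs i x))) → μ (tabulate fs) x ≡ 0
  μ-tabulate-undefined fs x undefined =
    cong length (filter-none (λ f → T? (is-just (f x))) (All.tabulate⁺ undefined))

  μ-tabulate-≤1 : ∀ {m} (fs : Fin m → PartialFn A) x →
                  (∀ i j → T (is-just (fs i x)) → T (is-just (fs j x)) → i ≡ j) →
                  μ (tabulate fs) x ≤ 1
  μ-tabulate-≤1 {zero}  fs x unique = z≤n
  μ-tabulate-≤1 {suc m} fs x unique with is-just (fs zero x) in defined
  ... | true  = s≤s (≤-reflexive (μ-tabulate-undefined (fs ∘ suc) x
                  (λ i dᵢ → 0≢1+n (unique zero (suc i) (subst T (sym defined) tt) dᵢ))))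
  ... | false = μ-tabulate-≤1 (fs ∘ suc) x
                  (λ i j dᵢ dⱼ → Fin-suc-injective (unique (suc i) (suc j) dᵢ dⱼ))

  μ-∘ : ∀ {B : Set} (g : A → B) (fs : List (PartialFn B)) x → μ (map (_∘ g) fs) x ≡ μ fs (g x)
  μ-∘ g []       x = refl
  μ-∘ g (f ∷ fs) x with is-just (f (g x))
  ... | true  = cong suc (μ-∘ g fs x)
  ... | false = μ-∘ g fs x

Ldim2AtMost-pullback : ∀ {A B : Set} {_≼_ : A → A → Set} {_≼′_ : B → B → Set} (g : A → B) →
                       (∀ {x y} → x ≼ y → g x ≼′ g y) → (∀ {x y} → g x ≼′ g y → x ≼ y) →
                       ∀ {m} → Ldim2AtMost _≼′_ m → Ldim2AtMost _≼_ m
Ldim2AtMost-pullback {_≼_ = _≼_} g preserves reflects {m} (R , (monotone , separates) , μ≤m) =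
  map (_∘ g) R , (monotone′ , separates′) , λ x → subst (_≤ m) (sym (μ-∘ g R x)) (μ≤m (g x))
  where
  monotone′ : ∀ f → f ∈ map (_∘ g) R → Monotone _≼_ f
  monotone′ f f∈ with ∈-map⁻ (_∘ g) f∈
  ... | f′ , f′∈R , refl = λ x y a b fx fy x≼y → monotone f′ f′∈R (g x) (g y) a b fx fy (preserves x≼y)

  separates′ : ∀ x y → ¬ (y ≼ x) → ∃ λ f → f ∈ map (_∘ g) R × f x ≡ just false × f y ≡ just true
  separates′ x y y⋠x with separates (g x) (g y) (y⋠x ∘ reflects)
  ... | f , f∈R , fx , fy = f ∘ g , ∈-map⁺ (_∘ g) f∈R , fx , fy

-- Subsets of a finite set

⊈⇒∃∈∉ : ∀ {n} {p q : Subset n} → ¬ p ⊆ q → ∃ λ x → x ∈ˢ p × x ∉ˢ q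
⊈⇒∃∈∉ {n} {p} {q} p⊈q
  with ¬∀⟶∃¬ n (λ x → x ∈ˢ p → x ∈ˢ q) (λ x → x ∈? p →-dec x ∈? q) (λ p⊆q → p⊈q (p⊆q _))
... | x , x∈p↛x∈q with x ∈? p
...   | yes x∈p = x , x∈p , λ x∈q → x∈p↛x∈q λ _ → x∈q
...   | no  x∉p = contradiction (λ x∈p → contradiction x∈p x∉p) x∈p↛x∈q

p⊆q∧∣q∣≤∣p∣⇒p≡q : ∀ {n} {p q : Subset n} → p ⊆ q → ∣ q ∣ ≤ ∣ p ∣ → p ≡ q
p⊆q∧∣q∣≤∣p∣⇒p≡q {p = p} {q} p⊆q ∣q∣≤∣p∣ with q ⊆? p
... | yes q⊆p = ⊆-antisym p⊆q q⊆p
... | no  q⊈p = contradiction (p⊂q⇒∣p∣<∣q∣ (p⊆q , ⊈⇒∃∈∉ q⊈p)) (≤⇒≯ ∣q∣≤∣p∣)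

∣p∣≡0⇒p≡⊥ : ∀ {n} (p : Subset n) → ∣ p ∣ ≡ 0 → p ≡ ⊥
∣p∣≡0⇒p≡⊥ []            _       = refl
∣p∣≡0⇒p≡⊥ (inside  ∷ p) ()
∣p∣≡0⇒p≡⊥ (outside ∷ p) ∣p∣≡0 = cong (outside ∷_) (∣p∣≡0⇒p≡⊥ p ∣p∣≡0)

∣p∣≡1⇒p≡⁅x⁆ : ∀ {n} (p : Subset n) → ∣ p ∣ ≡ 1 → ∃ λ x → p ≡ ⁅ x ⁆
∣p∣≡1⇒p≡⁅x⁆ (inside  ∷ p) ∣p∣≡1 = zero , cong (inside ∷_) (∣p∣≡0⇒p≡⊥ p (suc-injective ∣p∣≡1))
∣p∣≡1⇒p≡⁅x⁆ (outside ∷ p) ∣p∣≡1 with ∣p∣≡1⇒p≡⁅x⁆ p ∣p∣≡1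
... | x , refl = suc x , refl

∣p∣≡n∸1⇒p≡∁⁅x⁆ : ∀ {n} (p : Subset n) → 1 ≤ n → ∣ p ∣ ≡ n ∸ 1 → ∃ λ x → p ≡ ∁ ⁅ x ⁆
∣p∣≡n∸1⇒p≡∁⁅x⁆ {n} p 1≤n ∣p∣≡n∸1 with ∣p∣≡1⇒p≡⁅x⁆ (∁ p) ∣∁p∣≡1
  where
  ∣∁p∣≡1 : ∣ ∁ p ∣ ≡ 1
  ∣∁p∣≡1 = trans (∣∁p∣≡n∸∣p∣ p) (trans (cong (n ∸_) ∣p∣≡n∸1) (m∸[m∸n]≡n 1≤n))
... | x , ∁p≡⁅x⁆ = x , trans (sym (¬-involutive (∪-∩-booleanAlgebra n) p)) (cong ∁ ∁p≡⁅x⁆)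

lookup-injective : ∀ {A : Set} {xs : List A} → Unique xs → ∀ i j → lookup xs i ≡ lookup xs j → i ≡ j
lookup-injective (_    ∷ _) zero    zero    _  = refl
lookup-injective (x∉xs ∷ _) zero    (suc j) eq = contradiction eq (All-lookup x∉xs (∈-lookup j))
lookup-injective (x∉xs ∷ _) (suc i) zero    eq = contradiction (sym eq) (All-lookup x∉xs (∈-lookup i))
lookup-injective (_    ∷ u) (suc i) (suc j) eq = cong suc (lookup-injective u i j eq)

-- The standard example as atoms and coatoms

data Shape (n : ℕ) : Set where
  atom coatom : Fin n → Shape n

module _ {n : ℕ} where

  index : Shape n → Fin n
  index (atom i)   = i
  index (coatom i) = i

  isAtom : Shape n → Bool
  isAtom (atom _)   = true
  isAtom (coatom _) = false

  infix 4 _≼_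
  data _≼_ : Shape n → Shape n → Set where
    atom≼atom     : ∀ {i} → atom i ≼ atom i
    coatom≼coatom : ∀ {i} → coatom i ≼ coatom i
    atom≼coatom   : ∀ {i j} → i ≢ j → atom i ≼ coatom j

  ≼-monotone : ∀ {f : PartialFn (Shape n)} →
               (∀ {i j a b} → i ≢ j → f (atom i) ≡ just a → f (coatom j) ≡ just b → a Bool.≤ b) →
               Monotone _≼_ f
  ≼-monotone {f} _ _ _ _ _ fs ft atom≼atom         = same-point⇒≤ {f = f} fs ft
  ≼-monotone {f} _ _ _ _ _ fs ft coatom≼coatom     = same-point⇒≤ {f = f} fs ft
  ≼-monotone     h _ _ _ _ fs ft (atom≼coatom i≢j) = h i≢j fs ft

IsAntichain : ∀ {n K} → (Fin n → Subset K) → Set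
IsAntichain code = ∀ i j → code i ⊆ code j → i ≡ j

module _ {n K : ℕ} (code : Fin n → Subset K) where

  coordinate : Fin K → Fin n → Bool
  coordinate k i = does (k ∈? code i)

  antichain-separates : IsAntichain code → ∀ {i j} → i ≢ j →
                        ∃ λ k → coordinate k i ≡ false × coordinate k j ≡ true
  antichain-separates antichain {i} {j} i≢j with ⊈⇒∃∈∉ (λ ⊆ → i≢j (sym (antichain j i ⊆)))
  ... | k , k∈j , k∉i = k , dec-false (k ∈? code i) k∉i , dec-true (k ∈? code j) k∈j

  atomCoordinate coatomCoordinate : Fin K → PartialFn (Shape n)
  atomCoordinate k (atom i)   = just (coordinate k i)
  atomCoordinate k (coatom _) = nothing
  coatomCoordinate k (atom _)   = nothing
  coatomCoordinate k (coatom i) = just (coordinate k i)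

  rank : PartialFn (Shape n)
  rank s = just (not (isAtom s))

  pairAt : Fin n → PartialFn (Shape n)
  pairAt j s = when (does (index s ≟ j)) (isAtom s)

  pairAt-defined : ∀ {j} s → T (is-just (pairAt j s)) → index s ≡ j
  pairAt-defined {j} s d with index s ≟ j
  ... | yes e = e
  ... | no  _ = ⊥-elim d

  shapeRealiser : List (PartialFn (Shape n))
  shapeRealiser = tabulate atomCoordinate ++ tabulate coatomCoordinate ++ rank ∷ tabulate pairAt

  atomCoordinate-monotone : ∀ k → Monotone _≼_ (atomCoordinate k)
  atomCoordinate-monotone k = ≼-monotone λ _ _ ()

  coatomCoordinate-monotone : ∀ k → Monotone _≼_ (coatomCoordinate k)
  coatomCoordinate-monotone k = ≼-monotone λ _ ()

  rank-monotone : Monotone _≼_ rank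
  rank-monotone = ≼-monotone λ { _ refl refl → f≤t }

  pairAt-monotone : ∀ j → Monotone _≼_ (pairAt j)
  pairAt-monotone j = ≼-monotone λ {i} {i′} i≢i′ fi fi′ →
    ⊥-elim (i≢i′ (trans (pairAt-defined (atom i) (defined fi))
                        (sym (pairAt-defined (coatom i′) (defined fi′)))))
    where
    defined : ∀ {m : Maybe Bool} {a} → m ≡ just a → T (is-just m)
    defined refl = tt

  shapeRealiser-monotone : All (Monotone _≼_) shapeRealiser
  shapeRealiser-monotone =
    All.++⁺ (All.tabulate⁺ atomCoordinate-monotone)
   (All.++⁺ (All.tabulate⁺ coatomCoordinate-monotone)
   (rank-monotone ∷ All.tabulate⁺ pairAt-monotone))

  shapeRealiser-separates : IsAntichain code → ∀ s t → ¬ (t ≼ s) →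
                            ∃ λ f → f ∈ shapeRealiser × f s ≡ just false × f t ≡ just true
  shapeRealiser-separates antichain (atom i) (atom j) t⋠s
    with antichain-separates antichain {i} {j} (λ { refl → t⋠s atom≼atom })
  ... | k , kᵢ , kⱼ = atomCoordinate k , ∈-++⁺ˡ (∈-tabulate⁺ k) , cong just kᵢ , cong just kⱼ
  shapeRealiser-separates antichain (coatom i) (coatom j) t⋠s
    with antichain-separates antichain {i} {j} (λ { refl → t⋠s coatom≼coatom })
  ... | k , kᵢ , kⱼ =
    coatomCoordinate k ,
    ∈-++⁺ʳ (tabulate atomCoordinate) (∈-++⁺ˡ (∈-tabulate⁺ k)) ,
    cong just kᵢ ,
    cong just kⱼ
  shapeRealiser-separates antichain (atom i) (coatom j) _ =
    rank ,
    ∈-++⁺ʳ (tabulate atomCoordinate) (∈-++⁺ʳ (tabulate coatomCoordinate) (here refl)) ,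
    refl ,
    refl
  shapeRealiser-separates antichain (coatom i) (atom j) t⋠s with j ≟ i
  ... | no j≢i   = contradiction (atom≼coatom j≢i) t⋠s
  ... | yes refl =
    pairAt i ,
    ∈-++⁺ʳ (tabulate atomCoordinate) (∈-++⁺ʳ (tabulate coatomCoordinate) (there (∈-tabulate⁺ i))) ,
    cong (λ b → when b false) (dec-true (i ≟ i) refl) ,
    cong (λ b → when b true) (dec-true (i ≟ i) refl)

  μ-shapeRealiser : ∀ s → μ shapeRealiser s ≤ K + 2
  μ-shapeRealiser s = begin
    μ shapeRealiser s                            ≡⟨ μ-++ atoms (coatoms ++ rank ∷ pairs) s ⟩
    μ atoms s + μ (coatoms ++ rank ∷ pairs) s    ≡⟨ cong (μ atoms s +_) (μ-++ coatoms (rank ∷ pairs) s) ⟩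
    μ atoms s + (μ coatoms s + suc (μ pairs s))  ≤⟨ bound s ⟩
    K + 2                                        ∎
    where
    open ≤-Reasoning
    atoms coatoms pairs : List (PartialFn (Shape n))
    atoms   = tabulate atomCoordinate
    coatoms = tabulate coatomCoordinate
    pairs   = tabulate pairAt

    μ-pairs : ∀ s → μ pairs s ≤ 1
    μ-pairs s = μ-tabulate-≤1 pairAt s λ i j dᵢ dⱼ →
      trans (sym (pairAt-defined s dᵢ)) (pairAt-defined s dⱼ)

    bound : ∀ s → μ atoms s + (μ coatoms s + suc (μ pairs s)) ≤ K + 2
    bound s@(atom _) =
      +-mono-≤ (μ-tabulate-≤ atomCoordinate s)
               (subst (λ c → c + suc (μ pairs s) ≤ 2)
                      (sym (μ-tabulate-undefined coatomCoordinate s λ _ ())) (s≤s (μ-pairs s)))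
    bound s@(coatom _) =
      subst (λ a → a + (μ coatoms s + suc (μ pairs s)) ≤ K + 2)
            (sym (μ-tabulate-undefined atomCoordinate s λ _ ()))
            (+-mono-≤ (μ-tabulate-≤ coatomCoordinate s) (s≤s (μ-pairs s)))

  antichain⇒Ldim2AtMost-≼ : IsAntichain code → Ldim2AtMost _≼_ (K + 2)
  antichain⇒Ldim2AtMost-≼ antichain =
    shapeRealiser ,
    ((λ _ → All-lookup shapeRealiser-monotone) , shapeRealiser-separates antichain) ,
    μ-shapeRealiser

module _ {n : ℕ} where

  ⟦_⟧ : Shape n → Subset n
  ⟦ atom i   ⟧ = ⁅ i ⁆
  ⟦ coatom i ⟧ = ∁ ⁅ i ⁆

  -- For n = 2 every singleton is also a co-singleton; reading such points as atoms is what
  -- excludes ⟦ coatom i ⟧ ⊆ ⟦ atom j ⟧ in ⊆⇒≼.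
  Canonical : Shape n → Set
  Canonical (atom _)   = ⊤
  Canonical (coatom i) = 2 ≤ ∣ ∁ ⁅ i ⁆ ∣

  ≼⇒⊆ : ∀ {s t} → s ≼ t → ⟦ s ⟧ ⊆ ⟦ t ⟧
  ≼⇒⊆ atom≼atom                       x∈s = x∈s
  ≼⇒⊆ coatom≼coatom                   x∈s = x∈s
  ≼⇒⊆ (atom≼coatom {i} {j} i≢j) {x} x∈⁅i⁆ =
    x∉p⇒x∈∁p (x≢y⇒x∉⁅y⁆ λ x≡j → i≢j (trans (sym (x∈⁅y⁆⇒x≡y i x∈⁅i⁆)) x≡j))

  ⊆⇒≼ : ∀ {s t} → Canonical s → ⟦ s ⟧ ⊆ ⟦ t ⟧ → s ≼ t
  ⊆⇒≼ {atom i}   {atom j}   _ s⊆t with x∈⁅y⁆⇒x≡y j (s⊆t (x∈⁅x⁆ i))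
  ... | refl = atom≼atom
  ⊆⇒≼ {atom i}   {coatom j} _ s⊆t = atom≼coatom (x∉⁅y⁆⇒x≢y (x∈∁p⇒x∉p (s⊆t (x∈⁅x⁆ i))))
  ⊆⇒≼ {coatom i} {coatom j} _ s⊆t with x∈⁅y⁆⇒x≡y i (∁p⊆∁q⇒p⊇q s⊆t (x∈⁅x⁆ j))
  ... | refl = coatom≼coatom
  ⊆⇒≼ {coatom i} {atom j} 2≤∣s∣ s⊆t
    with ≤-trans 2≤∣s∣ (≤-trans (p⊆q⇒∣p∣≤∣q∣ s⊆t) (≤-reflexive (∣⁅x⁆∣≡1 j)))
  ... | s≤s ()

module _ {n : ℕ} (2≤n : 2 ≤ n) where

  shape : (x : Sₙ n) → Σ (Shape n) λ s → Canonical s × proj₁ x ≡ ⟦ s ⟧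
  shape (p , p∈Sₙ) with ∣ p ∣ ≟ℕ 1 | Equivalence.to (T-∨ {∣ p ∣ ≡ᵇ 1} {∣ p ∣ ≡ᵇ n ∸ 1}) p∈Sₙ
  ... | yes ∣p∣≡1 | _ with ∣p∣≡1⇒p≡⁅x⁆ p ∣p∣≡1
  ...   | i , p≡⁅i⁆ = atom i , tt , p≡⁅i⁆
  shape (p , _) | no ∣p∣≢1 | inj₁ ∣p∣≡ᵇ1 = contradiction (≡ᵇ⇒≡ ∣ p ∣ 1 ∣p∣≡ᵇ1) ∣p∣≢1
  shape (p , _) | no ∣p∣≢1 | inj₂ ∣p∣≡ᵇn∸1 with ∣p∣≡n∸1⇒p≡∁⁅x⁆ p (≤-trans (s≤s z≤n) 2≤n) ∣p∣≡n∸1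
    where
    ∣p∣≡n∸1 : ∣ p ∣ ≡ n ∸ 1
    ∣p∣≡n∸1 = ≡ᵇ⇒≡ ∣ p ∣ (n ∸ 1) ∣p∣≡ᵇn∸1
  ... | i , p≡∁⁅i⁆ = coatom i , subst (λ q → 2 ≤ ∣ q ∣) p≡∁⁅i⁆ 2≤∣p∣ , p≡∁⁅i⁆
    where
    1≤∣p∣ : 1 ≤ ∣ p ∣
    1≤∣p∣ = subst (1 ≤_) (sym (≡ᵇ⇒≡ ∣ p ∣ (n ∸ 1) ∣p∣≡ᵇn∸1)) (∸-monoˡ-≤ 1 2≤n)
    2≤∣p∣ : 2 ≤ ∣ p ∣
    2≤∣p∣ = ≤∧≢⇒< 1≤∣p∣ (∣p∣≢1 ∘ sym)

  shapeOf : Sₙ n → Shape n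
  shapeOf x = proj₁ (shape x)

  ⊑⇒≼ : ∀ {x y} → x ⊑ y → shapeOf x ≼ shapeOf y
  ⊑⇒≼ {x} {y} x⊑y with shape x | shape y
  ... | s , canonical , x≡s | t , _ , y≡t = ⊆⇒≼ canonical (subst₂ _⊆_ x≡s y≡t x⊑y)

  ≼⇒⊑ : ∀ {x y} → shapeOf x ≼ shapeOf y → x ⊑ y
  ≼⇒⊑ {x} {y} s≼t with shape x | shape y
  ... | s , _ , x≡s | t , _ , y≡t = subst₂ _⊆_ (sym x≡s) (sym y≡t) (≼⇒⊆ s≼t)

antichain⇒Ldim2AtMost : ∀ {n K} → 2 ≤ n → (code : Fin n → Subset K) → IsAntichain code →
                        Ldim2AtMost (_⊑_ {n}) (K + 2)
antichain⇒Ldim2AtMost 2≤n code antichain =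
  Ldim2AtMost-pullback (shapeOf 2≤n) (⊑⇒≼ 2≤n) (≼⇒⊑ 2≤n) (antichain⇒Ldim2AtMost-≼ code antichain)

-- Antichains of equal-size subsets

subsetsOfSize : ∀ K → ℕ → List (Subset K)
subsetsOfSize zero    zero    = [] ∷ []
subsetsOfSize zero    (suc r) = []
subsetsOfSize (suc K) zero    = map (outside ∷_) (subsetsOfSize K zero)
subsetsOfSize (suc K) (suc r) =
  map (inside ∷_) (subsetsOfSize K r) ++ map (outside ∷_) (subsetsOfSize K (suc r))

subsetsOfSize-∣p∣≡r : ∀ K r → All (λ p → ∣ p ∣ ≡ r) (subsetsOfSize K r)
subsetsOfSize-∣p∣≡r zero    zero    = refl ∷ []
subsetsOfSize-∣p∣≡r zero    (suc r) = []
subsetsOfSize-∣p∣≡r (suc K) zero    = All.map⁺ (subsetsOfSize-∣p∣≡r K zero)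
subsetsOfSize-∣p∣≡r (suc K) (suc r) =
  All.++⁺ (All.map⁺ (All-map (cong suc) (subsetsOfSize-∣p∣≡r K r)))
          (All.map⁺ (subsetsOfSize-∣p∣≡r K (suc r)))

subsetsOfSize-unique : ∀ K r → Unique (subsetsOfSize K r)
subsetsOfSize-unique zero    zero    = [] ∷ []
subsetsOfSize-unique zero    (suc r) = []
subsetsOfSize-unique (suc K) zero    = Unique.map⁺ ∷-injectiveʳ (subsetsOfSize-unique K zero)
subsetsOfSize-unique (suc K) (suc r) =
  Unique.++⁺ (Unique.map⁺ ∷-injectiveʳ (subsetsOfSize-unique K r))
             (Unique.map⁺ ∷-injectiveʳ (subsetsOfSize-unique K (suc r)))
             (λ (v∈ins , v∈outs) →
                contradiction (trans (sym (head-∈-map v∈ins)) (head-∈-map v∈outs)) λ ())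
  where
  head-∈-map : ∀ {b} {v : Subset (suc K)} {ps} → v ∈ map (b ∷_) ps → head v ≡ b
  head-∈-map {b} v∈ with ∈-map⁻ (b ∷_) v∈
  ... | _ , _ , refl = refl

length-subsetsOfSize : ∀ K r → length (subsetsOfSize K r) ≡ K C r
length-subsetsOfSize zero    zero    = refl
length-subsetsOfSize zero    (suc r) = sym (k>n⇒nCk≡0 {0} {suc r} z<s)
length-subsetsOfSize (suc K) zero    =
  trans (length-map (outside ∷_) (subsetsOfSize K zero)) (length-subsetsOfSize K zero)
length-subsetsOfSize (suc K) (suc r) = begin
  length (ins ++ outs)       ≡⟨ length-++ ins ⟩
  length ins + length outs   ≡⟨ cong₂ _+_ (trans (length-map (inside Vec.∷_) (subsetsOfSize K r))
                                                 (length-subsetsOfSize K r))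
                                          (trans (length-map (outside Vec.∷_) (subsetsOfSize K (suc r)))
                                                 (length-subsetsOfSize K (suc r))) ⟩
  K C r + K C suc r          ≡⟨ nCk+nC[k+1]≡[n+1]C[k+1] K r ⟩
  suc K C suc r              ∎
  where
  open ≡-Reasoning
  ins outs : List (Subset (suc K))
  ins  = map (inside ∷_) (subsetsOfSize K r)
  outs = map (outside ∷_) (subsetsOfSize K (suc r))

antichainOfSize : ∀ {n K} r → n ≤ K C r → Σ (Fin n → Subset K) IsAntichain
antichainOfSize {n} {K} r n≤KCr = code , antichain
  where
  n≤length : n ≤ length (subsetsOfSize K r)
  n≤length = subst (n ≤_) (sym (length-subsetsOfSize K r)) n≤KCr

  code : Fin n → Subset K
  code i = lookup (subsetsOfSize K r) (inject≤ i n≤length)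

  ∣code∣ : ∀ i → ∣ code i ∣ ≡ r
  ∣code∣ i = All-lookup (subsetsOfSize-∣p∣≡r K r) (∈-lookup (inject≤ i n≤length))

  antichain : IsAntichain code
  antichain i j ci⊆cj =
    inject≤-injective n≤length n≤length i j
      (lookup-injective (subsetsOfSize-unique K r) _ _
        (p⊆q∧∣q∣≤∣p∣⇒p≡q ci⊆cj (≤-reflexive (trans (∣code∣ j) (sym (∣code∣ i))))))

-- Central binomial coefficients

[k+1]*[n+1]C[k+1]≡[n+1]*nCk : ∀ n k → suc k * (suc n C suc k) ≡ suc n * (n C k)
[k+1]*[n+1]C[k+1]≡[n+1]*nCk zero    zero    = refl
[k+1]*[n+1]C[k+1]≡[n+1]*nCk zero    (suc k) = begin
  suc (suc k) * (1 C suc (suc k))   ≡⟨ cong (suc (suc k) *_) (k>n⇒nCk≡0 {1} {suc (suc k)} (s<s z<s)) ⟩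
  suc (suc k) * 0                   ≡⟨ *-zeroʳ (suc (suc k)) ⟩
  0                                 ≡⟨ cong (1 *_) (k>n⇒nCk≡0 {0} {suc k} z<s) ⟨
  1 * (0 C suc k)                   ∎
  where open ≡-Reasoning
[k+1]*[n+1]C[k+1]≡[n+1]*nCk (suc n) zero    =
  trans (+-identityʳ _) (trans (nC1≡n (suc (suc n))) (sym (*-identityʳ (suc (suc n)))))
[k+1]*[n+1]C[k+1]≡[n+1]*nCk (suc m) (suc j) = begin
  suc (suc j) * (suc n C suc (suc j))
    ≡⟨ cong (suc (suc j) *_) (nCk+nC[k+1]≡[n+1]C[k+1] n (suc j)) ⟨
  suc (suc j) * (a + b)
    ≡⟨ *-distribˡ-+ (suc (suc j)) a b ⟩
  a + suc j * a + suc (suc j) * b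
    ≡⟨ cong₂ (λ u v → a + u + v) ([k+1]*[n+1]C[k+1]≡[n+1]*nCk m j)
                                  ([k+1]*[n+1]C[k+1]≡[n+1]*nCk m (suc j)) ⟩
  a + n * (m C j) + n * (m C suc j)
    ≡⟨ +-assoc a _ _ ⟩
  a + (n * (m C j) + n * (m C suc j))
    ≡⟨ cong (a +_) (*-distribˡ-+ n (m C j) (m C suc j)) ⟨
  a + n * (m C j + m C suc j)
    ≡⟨ cong (λ c → a + n * c) (nCk+nC[k+1]≡[n+1]C[k+1] m j) ⟩
  suc n * a
    ∎
  where
  open ≡-Reasoning
  n a b : ℕ
  n = suc m
  a = n C suc j
  b = n C suc (suc j)

oddCentral : ℕ → ℕ
oddCentral t = suc (t + t) C t

oddCentral-symmetric : ∀ t → suc (t + t) C suc t ≡ oddCentral t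
oddCentral-symmetric t = trans (nCk≡nC[n∸k] (s≤s (m≤n+m t t))) (cong (suc (t + t) C_) (m+n∸n≡m t t))

[2+2t]C[1+t]≡2×oddCentral : ∀ t → suc (suc (t + t)) C suc t ≡ oddCentral t + oddCentral t
[2+2t]C[1+t]≡2×oddCentral t =
  trans (sym (nCk+nC[k+1]≡[n+1]C[k+1] (suc (t + t)) t))
        (cong (oddCentral t +_) (oddCentral-symmetric t))

oddCentral-recurrence : ∀ t →
  (2 + t) * oddCentral (suc t) ≡ (3 + (t + t)) * (oddCentral t + oddCentral t)
oddCentral-recurrence t = begin
  (2 + t) * oddCentral (suc t)
    ≡⟨ cong ((2 + t) *_) (oddCentral-symmetric (suc t)) ⟨
  (2 + t) * (suc (suc t + suc t) C (2 + t))
    ≡⟨ [k+1]*[n+1]C[k+1]≡[n+1]*nCk (suc t + suc t) (suc t) ⟩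
  suc (suc t + suc t) * ((suc t + suc t) C suc t)
    ≡⟨ cong (λ m → suc m * (m C suc t)) (cong suc (+-suc t t)) ⟩
  (3 + (t + t)) * (suc (suc (t + t)) C suc t)
    ≡⟨ cong ((3 + (t + t)) *_) ([2+2t]C[1+t]≡2×oddCentral t) ⟩
  (3 + (t + t)) * (oddCentral t + oddCentral t)
    ∎
  where open ≡-Reasoning

4^[2+2t]≡16*4^[2t] : ∀ t → 4 ^ (suc t + suc t) ≡ 16 * 4 ^ (t + t)
4^[2+2t]≡16*4^[2t] t = trans (cong (λ e → 4 * 4 ^ e) (+-suc t t)) (sym (*-assoc 4 4 (4 ^ (t + t))))

-- The induction step rests on (2t + 3)² = 4 (t + 1) (t + 2) + 1.
oddCentral-lowerBound : ∀ t → 4 ^ (t + t) ≤ suc t * (oddCentral t * oddCentral t)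
oddCentral-lowerBound zero    = ≤-refl
oddCentral-lowerBound (suc t) = *-cancelˡ-≤ (2 + t) (begin
  (2 + t) * 4 ^ (suc t + suc t)
    ≡⟨ cong ((2 + t) *_) (4^[2+2t]≡16*4^[2t] t) ⟩
  (2 + t) * (16 * 4 ^ (t + t))
    ≤⟨ *-monoʳ-≤ (2 + t) (*-monoʳ-≤ 16 (oddCentral-lowerBound t)) ⟩
  (2 + t) * (16 * (suc t * (b * b)))
    ≤⟨ m≤m+n _ (4 * (b * b)) ⟩
  (2 + t) * (16 * (suc t * (b * b))) + 4 * (b * b)
    ≡⟨ square-gap t b ⟩
  ((3 + (t + t)) * (b + b)) * ((3 + (t + t)) * (b + b))
    ≡⟨ cong₂ _*_ (oddCentral-recurrence t) (oddCentral-recurrence t) ⟨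
  ((2 + t) * b′) * ((2 + t) * b′)
    ≡⟨ regroup (2 + t) b′ ⟩
  (2 + t) * ((2 + t) * (b′ * b′))
    ∎)
  where
  open ≤-Reasoning
  b b′ : ℕ
  b = oddCentral t
  b′ = oddCentral (suc t)
  square-gap : ∀ t b → (2 + t) * (16 * (suc t * (b * b))) + 4 * (b * b)
                       ≡ ((3 + (t + t)) * (b + b)) * ((3 + (t + t)) * (b + b))
  square-gap = solve-∀
  regroup : ∀ x y → (x * y) * (x * y) ≡ x * (x * (y * y))
  regroup = solve-∀

oddCentral-doubles : ∀ t → oddCentral t + oddCentral t ≤ oddCentral (suc t)
oddCentral-doubles t = *-cancelˡ-≤ (2 + t) (begin
  (2 + t) * (oddCentral t + oddCentral t)
    ≤⟨ *-monoˡ-≤ (oddCentral t + oddCentral t) (s≤s (s≤s (≤-trans (m≤n+m t t) (n≤1+n (t + t))))) ⟩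
  (3 + (t + t)) * (oddCentral t + oddCentral t)
    ≡⟨ oddCentral-recurrence t ⟨
  (2 + t) * oddCentral (suc t)
    ∎)
  where open ≤-Reasoning

oddCentral-growth : ∀ s → 2 ^ (3 + s) ≤ oddCentral (2 + s)
oddCentral-growth zero    = ≤ᵇ⇒≤ 8 (oddCentral 2) _
oddCentral-growth (suc s) = begin
  2 * 2 ^ (3 + s)                           ≤⟨ *-monoʳ-≤ 2 (oddCentral-growth s) ⟩
  2 * oddCentral (2 + s)                    ≡⟨ cong (oddCentral (2 + s) +_) (+-identityʳ _) ⟩
  oddCentral (2 + s) + oddCentral (2 + s)   ≤⟨ oddCentral-doubles (2 + s) ⟩
  oddCentral (3 + s)                        ∎
  where open ≤-Reasoning

centralBinomial : ℕ → ℕ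
centralBinomial K = K C ⌊ K /2⌋

centralBinomial-odd : ∀ t → centralBinomial (suc (t + t)) ≡ oddCentral t
centralBinomial-odd t = cong (suc (t + t) C_) (sym (n≡⌈n+n/2⌉ t))

centralBinomial-even : ∀ t → centralBinomial (suc (suc (t + t))) ≡ oddCentral t + oddCentral t
centralBinomial-even t =
  trans (cong (λ k → suc (suc (t + t)) C suc k) (sym (n≡⌊n+n/2⌋ t))) ([2+2t]C[1+t]≡2×oddCentral t)

data ParityView : ℕ → Set where
  zero : ParityView 0
  odd  : ∀ t → ParityView (suc (t + t))
  even : ∀ t → ParityView (suc (suc (t + t)))

parityView : ∀ n → ParityView n
parityView zero = zero
parityView (suc n) with parityView n
... | zero   = odd 0
... | odd t  = even t
... | even t = subst ParityView (cong (2 +_) (+-suc t t)) (odd (suc t))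

centralBinomial-lowerBound : ∀ K → 4 ^ K ≤ 2 * suc K * (centralBinomial K * centralBinomial K)
centralBinomial-lowerBound K with parityView K
... | zero = s≤s z≤n
... | odd t rewrite centralBinomial-odd t = begin
  4 * 4 ^ (t + t)                   ≤⟨ *-monoʳ-≤ 4 (oddCentral-lowerBound t) ⟩
  4 * (suc t * (b * b))             ≡⟨ regroup t (b * b) ⟩
  2 * (2 + (t + t)) * (b * b)       ∎
  where
  open ≤-Reasoning
  b : ℕ
  b = oddCentral t
  regroup : ∀ t x → 4 * (suc t * x) ≡ 2 * (2 + (t + t)) * x
  regroup = solve-∀
... | even t rewrite centralBinomial-even t = begin
  4 * (4 * 4 ^ (t + t))                   ≡⟨ *-assoc 4 4 (4 ^ (t + t)) ⟨
  16 * 4 ^ (t + t)                        ≤⟨ *-monoʳ-≤ 16 (oddCentral-lowerBound t) ⟩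
  16 * (suc t * (b * b))                  ≤⟨ m≤m+n _ (8 * (b * b)) ⟩
  16 * (suc t * (b * b)) + 8 * (b * b)    ≡⟨ square-gap t b ⟩
  2 * (3 + (t + t)) * ((b + b) * (b + b)) ∎
  where
  open ≤-Reasoning
  b : ℕ
  b = oddCentral t
  square-gap : ∀ t b → 16 * (suc t * (b * b)) + 8 * (b * b) ≡ 2 * (3 + (t + t)) * ((b + b) * (b + b))
  square-gap = solve-∀

-- Choice of the code length

crossing : ∀ (f : ℕ → ℕ) {n} K → f 0 < n → n ≤ f K → ∃ λ J → J < K × f J < n × n ≤ f (suc J)
crossing f zero    f0<n n≤f0 = contradiction n≤f0 (<⇒≱ f0<n)
crossing f (suc K) f0<n n≤f[1+K] with _ ≤? f K
... | no n≰fK = K , n<1+n K , ≰⇒> n≰fK , n≤f[1+K]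
... | yes n≤fK with crossing f K f0<n n≤fK
...   | J , J<K , below , above = J , m<n⇒m<1+n J<K , below , above

n<2^n : ∀ n → n < 2 ^ n
n<2^n zero    = s≤s z≤n
n<2^n (suc n) = begin
  1 + suc n       ≡⟨ +-comm 1 (suc n) ⟩
  suc n + 1       ≤⟨ +-mono-≤ (n<2^n n) (m^n>0 2 n) ⟩
  2 ^ n + 2 ^ n   ≡⟨ cong (2 ^ n +_) (+-identityʳ (2 ^ n)) ⟨
  2 ^ suc n       ∎
  where open ≤-Reasoning

⌊log₂⌋-exists : ∀ n → 1 ≤ n → ∃ λ L → 2 ^ L ≤ n × n < 2 ^ suc L
⌊log₂⌋-exists n 1≤n with crossing (2 ^_) {suc n} n (s≤s 1≤n) (n<2^n n)
... | L , _ , 2^L<1+n , 1+n≤2^[1+L] = L , ≤-pred 2^L<1+n , 1+n≤2^[1+L]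

leastCodeLength : ∀ {n} t → 2 ≤ n → n ≤ centralBinomial (2 + (t + t)) →
                  ∃ λ K → n ≤ centralBinomial K × 4 ^ K ≤ 16 * (n * n) * suc t
leastCodeLength {n} t 2≤n n≤C[2+2t] with crossing centralBinomial (2 + (t + t)) 2≤n n≤C[2+2t]
... | J , J<2+2t , C[J]<n , n≤C[1+J] = suc J , n≤C[1+J] , (begin
  4 * 4 ^ J
    ≤⟨ *-monoʳ-≤ 4 (centralBinomial-lowerBound J) ⟩
  4 * (2 * suc J * (centralBinomial J * centralBinomial J))
    ≤⟨ *-monoʳ-≤ 4 (*-mono-≤ (*-monoʳ-≤ 2 J<2+2t) (*-mono-≤ (<⇒≤ C[J]<n) (<⇒≤ C[J]<n))) ⟩
  4 * (2 * (2 + (t + t)) * (n * n))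
    ≡⟨ regroup t (n * n) ⟩
  16 * (n * n) * suc t
    ∎)
  where
  open ≤-Reasoning
  regroup : ∀ t x → 4 * (2 * (2 + (t + t)) * x) ≡ 16 * x * suc t
  regroup = solve-∀

codeLength-≥8 : ∀ n → 8 ≤ n → ∃₂ λ K L → n ≤ centralBinomial K × 2 ^ L ≤ n × 4 ^ K ≤ 16 * (n * n) * L
codeLength-≥8 n 8≤n with ⌊log₂⌋-exists n (≤-trans (s≤s z≤n) 8≤n)
... | 0 , _ , n<2 = contradiction n<2 (≤⇒≯ (≤-trans (s≤s (s≤s z≤n)) 8≤n))
... | 1 , _ , n<4 = contradiction n<4 (≤⇒≯ (≤-trans (s≤s (s≤s (s≤s (s≤s z≤n)))) 8≤n))
... | 2 , _ , n<8 = contradiction n<8 (≤⇒≯ 8≤n)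
... | L@(suc t@(suc (suc s))) , 2^L≤n , n<2^[1+L] =
  let K , n≤C[K] , 4^K≤ = leastCodeLength t (≤-trans (s≤s (s≤s z≤n)) 8≤n) n≤C[2L]
  in  K , L , n≤C[K] , 2^L≤n , 4^K≤
  where
  open ≤-Reasoning
  n≤C[2L] : n ≤ centralBinomial (2 + (t + t))
  n≤C[2L] = begin
    n                                  ≤⟨ <⇒≤ n<2^[1+L] ⟩
    2 * 2 ^ (3 + s)                    ≤⟨ *-monoʳ-≤ 2 (oddCentral-growth s) ⟩
    2 * oddCentral t                   ≡⟨ cong (oddCentral t +_) (+-identityʳ _) ⟩
    oddCentral t + oddCentral t        ≡⟨ centralBinomial-even t ⟨
    centralBinomial (2 + (t + t))      ∎

-- Below 8, n ≤ C(2⌊log n⌋, ⌊log n⌋) fails for n = 3 and n = 7, so K and L are tabulated.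
codeLength : ∀ n → 2 ≤ n → ∃₂ λ K L → n ≤ centralBinomial K × 2 ^ L ≤ n × 4 ^ K ≤ 16 * (n * n) * L
codeLength 1 (s≤s ())
codeLength 2 _ = 2 , 1 , ≤ᵇ⇒≤ _ _ _ , ≤ᵇ⇒≤ _ _ _ , ≤ᵇ⇒≤ _ _ _
codeLength 3 _ = 3 , 1 , ≤ᵇ⇒≤ _ _ _ , ≤ᵇ⇒≤ _ _ _ , ≤ᵇ⇒≤ _ _ _
codeLength 4 _ = 4 , 2 , ≤ᵇ⇒≤ _ _ _ , ≤ᵇ⇒≤ _ _ _ , ≤ᵇ⇒≤ _ _ _
codeLength 5 _ = 4 , 2 , ≤ᵇ⇒≤ _ _ _ , ≤ᵇ⇒≤ _ _ _ , ≤ᵇ⇒≤ _ _ _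
codeLength 6 _ = 4 , 2 , ≤ᵇ⇒≤ _ _ _ , ≤ᵇ⇒≤ _ _ _ , ≤ᵇ⇒≤ _ _ _
codeLength 7 _ = 5 , 2 , ≤ᵇ⇒≤ _ _ _ , ≤ᵇ⇒≤ _ _ _ , ≤ᵇ⇒≤ _ _ _
codeLength (suc (suc (suc (suc (suc (suc (suc (suc m)))))))) _ = codeLength-≥8 (8 + m) (m≤m+n 8 m)

doubleExponential-bound : ∀ {n L} K → 2 ^ L ≤ n → 4 ^ K ≤ 16 * (n * n) * L →
                          2 ^ (2 ^ (2 * (K + 2))) ≤ n ^ (256 * (n * n))
doubleExponential-bound {n} {L} K 2^L≤n 4^K≤ = begin
  2 ^ (2 ^ (2 * (K + 2)))     ≡⟨ cong (2 ^_) (^-*-assoc 2 2 (K + 2)) ⟨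
  2 ^ (4 ^ (K + 2))           ≤⟨ ^-monoʳ-≤ 2 4^[K+2]≤ ⟩
  2 ^ (L * (256 * (n * n)))   ≡⟨ ^-*-assoc 2 L (256 * (n * n)) ⟨
  (2 ^ L) ^ (256 * (n * n))   ≤⟨ ^-monoˡ-≤ (256 * (n * n)) 2^L≤n ⟩
  n ^ (256 * (n * n))         ∎
  where
  open ≤-Reasoning
  4^[K+2]≤ : 4 ^ (K + 2) ≤ L * (256 * (n * n))
  4^[K+2]≤ = begin
    4 ^ (K + 2)               ≡⟨ ^-distribˡ-+-* 4 K 2 ⟩
    4 ^ K * 16                ≤⟨ *-monoˡ-≤ 16 4^K≤ ⟩
    16 * (n * n) * L * 16     ≡⟨ regroup (n * n) L ⟩
    L * (256 * (n * n))       ∎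
    where
    regroup : ∀ x L → 16 * x * L * 16 ≡ L * (256 * x)
    regroup = solve-∀

corollary6 : (n : ℕ) → 2 ≤ n →
    ∃ λ (m : ℕ) → Ldim2AtMost (_⊑_ {n}) m × (2 ^ (2 ^ (2 * m)) ≤ n ^ (256 * (n * n)))
corollary6 n 2≤n with codeLength n 2≤n
... | K , L , n≤C[K] , 2^L≤n , 4^K≤ with antichainOfSize ⌊ K /2⌋ n≤C[K]
...   | code , antichain =
  K + 2 , antichain⇒Ldim2AtMost 2≤n code antichain , doubleExponential-bound K 2^L≤n 4^K≤
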